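{- Let $G=(V,E)$ be a finite simple undirected graph with $n=|V|$, let $k$ be an integer with $0\le k\le n-1$, and consider the integer program $(F_E(k))$ defined in the context. Let $C\subseteq V$ be a set of vertices forming a clique in $G$ and, for each $c\in C$, let $L_c\subseteq\{1,\ldots,n\}$ be a set of labels such that $|\ell-\ell'|\le k$ for all $c,c'\in C$, $\ell\in L_c$, $\ell'\in L_{c'}$. Then the inequality $$\sum_{c\in C}\sum_{\ell\in L_c}x^{\ell}_c\le 1$$ is valid for $(F_E(k))$, i.e., it is satisfied by every feasible solution of $(F_E(k))$.
   Context: For a graph $G=(V,E)$ with $n=|V|$ and an integer $k$, the feasibility integer program $(F_E(k))$ has binary variables $x^\ell_i\in\{0,1\}$ for $i\in V$, $\ell\in\{1,\ldots,n\}$ (meaning vertex $i$ receives label $\ell$) and constraints: $\sum_{i\in V}x^\ell_i=1$ for all $\ell\in\{1,\ldots,n\}$; $\sum_{\ell=1}^{n}x^\ell_i=1$ for all $i\in V$; and for every edge $\{i,i'\}\in E$ and every integer $\ell_2$ with $1\le\ell_2\le n-k$: $$\sum_{\ell_2\le\ell'\le\ell_2+k}\big(x^{\ell'}_i+x^{\ell'}_{i'}\big)\le 1.$$ An inequality is valid for $(F_E(k))$ if every $x$ satisfying all these constraints satisfies it. -}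

module Defs where

open import Data.Nat using (ℕ; zero; suc; _+_; _≤_; _<_; _≤?_)
open import Data.Fin using (Fin; toℕ)
import Data.Fin as F
open import Data.Bool using (Bool; true; false; if_then_else_; _∧_)
open import Relation.Nullary.Decidable using (⌊_⌋)
open import Relation.Binary.PropositionalEquality using (_≡_)
open import Relation.Nullary using (¬_)

record SimpleGraph (n : ℕ) : Set₁ where
  field
    Adj   : Fin n → Fin n → Set
    sym   : ∀ {i j} → Adj i j → Adj j i
    irrefl : ∀ {i} → ¬ Adj i i

∑ : (n : ℕ) → (Fin n → ℕ) → ℕ
∑ zero    f = 0
∑ (suc n) f = f F.zero + ∑ n (λ i → f (F.suc i))

-- Labels are Fin n; label ℓ : Fin n stands for the paper's label toℕ ℓ + 1.
-- An assignment x i ℓ = x^ℓ_i.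
Assignment : ℕ → Set
Assignment n = Fin n → Fin n → ℕ

windowSum : ∀ {n} → Assignment n → ℕ → ℕ → Fin n → Fin n → ℕ
windowSum {n} x k ℓ₂ i i' =
  ∑ n (λ ℓ' → if ⌊ ℓ₂ ≤? toℕ ℓ' ⌋ ∧ ⌊ toℕ ℓ' ≤? ℓ₂ + k ⌋
              then x i ℓ' + x i' ℓ' else 0)

record Feasible {n : ℕ} (G : SimpleGraph n) (k : ℕ) (x : Assignment n) : Set where
  field
    binary   : ∀ i ℓ → x i ℓ ≤ 1
    labelOne : ∀ ℓ → ∑ n (λ i → x i ℓ) ≡ 1
    vertexOne : ∀ i → ∑ n (λ ℓ → x i ℓ) ≡ 1
    -- paper: 1 ≤ ℓ₂ ≤ n - k (1-based), i.e. 0-based ℓ₂ with ℓ₂ + k < n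
    edge     : ∀ i i' → SimpleGraph.Adj G i i' → ∀ ℓ₂ → ℓ₂ + k < n →
               windowSum x k ℓ₂ i i' ≤ 1

-- Every vertex of C contributes at most 1 to the left-hand side, because its
-- labels sum to 1.  If two distinct vertices c, c' of C both contributed,
-- through labels ℓ ∈ L c and ℓ' ∈ L c', then |ℓ - ℓ'| ≤ k ≤ n - 1 lets us fit
-- both labels into one window [l, l + k] with an admissible start l; the
-- edge {c, c'} of the clique then violates its window constraint.
module Submission where

open import Defs
open import Data.Bool using (Bool; true; false; T; if_then_else_; _∧_)
open import Data.Bool.Properties using (T-∧; T-≡)
open import Data.Empty using (⊥)
open import Data.Fin using (Fin; zero; suc; toℕ)
open import Data.Fin.Properties using (suc-injective; toℕ≤pred[n])
open import Data.Fin.Subset using (Subset; _∈_)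
open import Data.Nat using (ℕ; zero; suc; _+_; _∸_; ∣_-_∣; _≤_; _<_; _≤?_; _<?_; z≤n; s≤s)
open import Data.Nat.Properties hiding (suc-injective)
open import Algebra.Properties.CommutativeSemigroup +-commutativeSemigroup using (interchange)
open import Data.Product using (_×_; _,_; ∃-syntax)
open import Data.Sum using (inj₁; inj₂)
open import Data.Vec using (lookup)
open import Data.Vec.Properties using (lookup⇒[]=)
open import Function using (_∘_)
open import Function.Bundles using (Equivalence)
open import Relation.Binary.PropositionalEquality using (_≡_; _≢_; refl; sym; cong; cong₂; subst; module ≡-Reasoning)
open import Relation.Nullary using (¬_; yes; no)
open import Relation.Nullary.Decidable using (⌊_⌋; fromWitness)

_when_ : ℕ → Bool → ℕ
v when b = if b then v else 0

when-≤ : ∀ b v → v when b ≤ v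
when-≤ true  v = ≤-refl
when-≤ false v = z≤n

T⇒when-≡ : ∀ {b} v → T b → v when b ≡ v
T⇒when-≡ {true}  v _ = refl
T⇒when-≡ {false} v ()

when-pos : ∀ b v → 0 < v when b → T b × 0 < v
when-pos true  v 0<v = _ , 0<v
when-pos false v ()

when-distrib-+ : ∀ b u v → (u + v) when b ≡ u when b + v when b
when-distrib-+ true  u v = refl
when-distrib-+ false u v = refl

T-lookup⇒∈ : ∀ {n} {p : Subset n} {i} → T (lookup p i) → i ∈ p
T-lookup⇒∈ {p = p} {i} t = lookup⇒[]= i p (Equivalence.to T-≡ t)

∑-cong : ∀ {n} {f g : Fin n → ℕ} → (∀ i → f i ≡ g i) → ∑ n f ≡ ∑ n g
∑-cong {zero}  f≗g = refl
∑-cong {suc n} f≗g = cong₂ _+_ (f≗g zero) (∑-cong (f≗g ∘ suc))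

∑-mono-≤ : ∀ {n} {f g : Fin n → ℕ} → (∀ i → f i ≤ g i) → ∑ n f ≤ ∑ n g
∑-mono-≤ {zero}  f≤g = z≤n
∑-mono-≤ {suc n} f≤g = +-mono-≤ (f≤g zero) (∑-mono-≤ (f≤g ∘ suc))

∑-distrib-+ : ∀ {n} (f g : Fin n → ℕ) → ∑ n (λ i → f i + g i) ≡ ∑ n f + ∑ n g
∑-distrib-+ {zero}  f g = refl
∑-distrib-+ {suc n} f g = begin
  f zero + g zero + ∑ n (λ i → f (suc i) + g (suc i))
    ≡⟨ cong (f zero + g zero +_) (∑-distrib-+ (f ∘ suc) (g ∘ suc)) ⟩
  f zero + g zero + (∑ n (f ∘ suc) + ∑ n (g ∘ suc))
    ≡⟨ interchange (f zero) (g zero) _ _ ⟩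
  f zero + ∑ n (f ∘ suc) + (g zero + ∑ n (g ∘ suc)) ∎
  where open ≡-Reasoning

term≤∑ : ∀ {n} (f : Fin n → ℕ) i → f i ≤ ∑ n f
term≤∑ f zero    = m≤m+n (f zero) _
term≤∑ f (suc i) = ≤-trans (term≤∑ (f ∘ suc) i) (m≤n+m _ (f zero))

∑-pos⇒∃-pos : ∀ {n} (f : Fin n → ℕ) → 0 < ∑ n f → ∃[ i ] 0 < f i
∑-pos⇒∃-pos {suc n} f 0<∑ with 0 <? f zero
... | yes 0<f0 = zero , 0<f0
... | no  0≮f0 with ∑-pos⇒∃-pos (f ∘ suc) (subst (0 <_) (cong (_+ ∑ n (f ∘ suc)) (n≤0⇒n≡0 (≮⇒≥ 0≮f0))) 0<∑)
...   | i , 0<fi = suc i , 0<fi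

∑≡0 : ∀ {n} {f : Fin n → ℕ} → (∀ i → f i ≡ 0) → ∑ n f ≡ 0
∑≡0 {zero}  f≡0 = refl
∑≡0 {suc n} f≡0 = cong₂ _+_ (f≡0 zero) (∑≡0 (f≡0 ∘ suc))

AtMostOnePositive : ∀ {n} → (Fin n → ℕ) → Set
AtMostOnePositive f = ∀ {i j} → i ≢ j → 0 < f i → 0 < f j → ⊥

∑≤1 : ∀ {n} {f : Fin n → ℕ} → (∀ i → f i ≤ 1) → AtMostOnePositive f → ∑ n f ≤ 1
∑≤1 {zero}          f≤1 one = z≤n
∑≤1 {suc n} {f = f} f≤1 one with 0 <? f zero
... | no 0≮f0 = begin
  f zero + ∑ n (f ∘ suc) ≡⟨ cong (_+ ∑ n (f ∘ suc)) (n≤0⇒n≡0 (≮⇒≥ 0≮f0)) ⟩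
  ∑ n (f ∘ suc)          ≤⟨ ∑≤1 (f≤1 ∘ suc) (λ i≢j → one (i≢j ∘ suc-injective)) ⟩
  1                      ∎
  where open ≤-Reasoning
... | yes 0<f0 = begin
  f zero + ∑ n (f ∘ suc) ≡⟨ cong (f zero +_) (∑≡0 rest≡0) ⟩
  f zero + 0             ≡⟨ +-identityʳ (f zero) ⟩
  f zero                 ≤⟨ f≤1 zero ⟩
  1                      ∎
  where
  open ≤-Reasoning
  rest≡0 : ∀ i → f (suc i) ≡ 0
  rest≡0 i = n≤0⇒n≡0 (≮⇒≥ (one {zero} {suc i} (λ ()) 0<f0))

∑-when-≤ : ∀ {n} (b : Fin n → Bool) (f : Fin n → ℕ) → ∑ n (λ i → f i when b i) ≤ ∑ n f
∑-when-≤ b f = ∑-mono-≤ (λ i → when-≤ (b i) (f i))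

∑-when-pos : ∀ {n} (b : Fin n → Bool) (f : Fin n → ℕ) →
             0 < ∑ n (λ i → f i when b i) → ∃[ i ] T (b i) × 0 < f i
∑-when-pos b f 0<∑ with ∑-pos⇒∃-pos _ 0<∑
... | i , 0<fi = i , when-pos (b i) (f i) 0<fi

Covers : ℕ → ℕ → ℕ → Set
Covers k l a = l ≤ a × a ≤ l + k

window-≤ : ∀ {m k a b} → k ≤ m → b ≤ m → a ≤ b → b ≤ a + k →
           ∃[ l ] l + k ≤ m × Covers k l a × Covers k l b
window-≤ {m} {k} {a} {b} k≤m b≤m a≤b b≤a+k with a + k ≤? m
... | yes a+k≤m = a , a+k≤m , (≤-refl , m≤m+n a k) , (a≤b , b≤a+k)
... | no  a+k≰m = m ∸ k , ≤-reflexive [m∸k]+k≡m ,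
                  (m∸k≤a , ≤-trans (≤-trans a≤b b≤m) (≤-reflexive (sym [m∸k]+k≡m))) ,
                  (≤-trans m∸k≤a a≤b , ≤-trans b≤m (≤-reflexive (sym [m∸k]+k≡m)))
  where
  [m∸k]+k≡m : m ∸ k + k ≡ m
  [m∸k]+k≡m = m∸n+n≡m k≤m
  m∸k≤a : m ∸ k ≤ a
  m∸k≤a = m≤n+o⇒m∸n≤o m k (subst (m ≤_) (+-comm a k) (<⇒≤ (≰⇒> a+k≰m)))

commonWindow : ∀ {m k a b} → k ≤ m → a ≤ m → b ≤ m → ∣ a - b ∣ ≤ k →
               ∃[ l ] l + k ≤ m × Covers k l a × Covers k l b
commonWindow {m} {k} {a} {b} k≤m a≤m b≤m ∣a-b∣≤k with ≤-total a b
... | inj₁ a≤b = window-≤ k≤m b≤m a≤b b≤a+k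
  where
  b≤a+k : b ≤ a + k
  b≤a+k = ≤-trans (m≤n+∣m-n∣ b a) (+-monoʳ-≤ a (subst (_≤ k) (∣-∣-comm a b) ∣a-b∣≤k))
... | inj₂ b≤a with window-≤ k≤m a≤m b≤a (≤-trans (m≤n+∣m-n∣ a b) (+-monoʳ-≤ b ∣a-b∣≤k))
...   | l , l+k≤m , b∈W , a∈W = l , l+k≤m , a∈W , b∈W

windowSum-≥ : ∀ {n} (x : Assignment n) {k l i j ℓ ℓ'} →
              Covers k l (toℕ ℓ) → Covers k l (toℕ ℓ') → x i ℓ + x j ℓ' ≤ windowSum x k l i j
windowSum-≥ {n} x {k} {l} {i} {j} {ℓ} {ℓ'} (l≤ℓ , ℓ≤l+k) (l≤ℓ' , ℓ'≤l+k) = begin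
  x i ℓ + x j ℓ'
    ≡⟨ sym (cong₂ _+_ (T⇒when-≡ (x i ℓ) (inW l≤ℓ ℓ≤l+k)) (T⇒when-≡ (x j ℓ') (inW l≤ℓ' ℓ'≤l+k))) ⟩
  x i ℓ when w ℓ + x j ℓ' when w ℓ'
    ≤⟨ +-mono-≤ (term≤∑ (λ t → x i t when w t) ℓ) (term≤∑ (λ t → x j t when w t) ℓ') ⟩
  ∑ n (λ t → x i t when w t) + ∑ n (λ t → x j t when w t)
    ≡⟨ sym (∑-distrib-+ (λ t → x i t when w t) (λ t → x j t when w t)) ⟩
  ∑ n (λ t → x i t when w t + x j t when w t)
    ≡⟨ sym (∑-cong λ t → when-distrib-+ (w t) (x i t) (x j t)) ⟩
  windowSum x k l i j ∎
  where
  open ≤-Reasoning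
  w : Fin n → Bool
  w t = ⌊ l ≤? toℕ t ⌋ ∧ ⌊ toℕ t ≤? l + k ⌋
  inW : ∀ {t} → l ≤ toℕ t → toℕ t ≤ l + k → T (w t)
  inW {t} l≤t t≤l+k = Equivalence.from (T-∧ {⌊ l ≤? toℕ t ⌋}) (fromWitness l≤t , fromWitness t≤l+k)

close-labels⇒¬Adj : ∀ {n} {G : SimpleGraph n} {k} {x : Assignment n} → Feasible G k x → k ≤ n ∸ 1 →
                    ∀ {i j ℓ ℓ'} → ∣ toℕ ℓ - toℕ ℓ' ∣ ≤ k →
                    0 < x i ℓ → 0 < x j ℓ' → ¬ SimpleGraph.Adj G i j
close-labels⇒¬Adj {suc m} {k = k} {x} feasible k≤m {i} {j} {ℓ} {ℓ'} close 0<xiℓ 0<xjℓ' adj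
  with commonWindow k≤m (toℕ≤pred[n] ℓ) (toℕ≤pred[n] ℓ') close
... | l , l+k≤m , ℓ∈W , ℓ'∈W = <-irrefl refl (begin-strict
  1                   <⟨ +-mono-≤ 0<xiℓ 0<xjℓ' ⟩
  x i ℓ + x j ℓ'      ≤⟨ windowSum-≥ x ℓ∈W ℓ'∈W ⟩
  windowSum x k l i j ≤⟨ Feasible.edge feasible i j adj l (s≤s l+k≤m) ⟩
  1                   ∎)
  where open ≤-Reasoning

mainTheorem4 : (n : ℕ) (G : SimpleGraph n) (k : ℕ) → k ≤ n ∸ 1 →
    (C : Subset n) →
    (∀ c c' → c ∈ C → c' ∈ C → c ≢ c' → SimpleGraph.Adj G c c') →
    (L : Fin n → Subset n) →
    (∀ c c' ℓ ℓ' → c ∈ C → c' ∈ C → ℓ ∈ L c → ℓ' ∈ L c' → ∣ toℕ ℓ - toℕ ℓ' ∣ ≤ k) →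
    (x : Assignment n) → Feasible G k x →
    ∑ n (λ c → ∑ n (λ ℓ → if lookup C c ∧ lookup (L c) ℓ then x c ℓ else 0)) ≤ 1
mainTheorem4 n G k k≤n∸1 C clique L close x feasible = ∑≤1 contribution≤1 atMostOneContributes
  where
  selected : Fin n → Fin n → Bool
  selected c ℓ = lookup C c ∧ lookup (L c) ℓ

  contribution : Fin n → ℕ
  contribution c = ∑ n (λ ℓ → x c ℓ when selected c ℓ)

  contribution≤1 : ∀ c → contribution c ≤ 1
  contribution≤1 c = ≤-trans (∑-when-≤ (selected c) (x c)) (≤-reflexive (Feasible.vertexOne feasible c))

  selected⇒∈ : ∀ {c ℓ} → T (selected c ℓ) → c ∈ C × ℓ ∈ L c
  selected⇒∈ {c} sel with Equivalence.to (T-∧ {lookup C c}) sel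
  ... | c∈C , ℓ∈Lc = T-lookup⇒∈ c∈C , T-lookup⇒∈ ℓ∈Lc

  atMostOneContributes : AtMostOnePositive contribution
  atMostOneContributes {c} {c'} c≢c' 0<contrib 0<contrib'
    with ∑-when-pos (selected c) (x c) 0<contrib | ∑-when-pos (selected c') (x c') 0<contrib'
  ... | ℓ , sel , 0<xcℓ | ℓ' , sel' , 0<xc'ℓ'
    with selected⇒∈ sel | selected⇒∈ sel'
  ...   | c∈C , ℓ∈Lc | c'∈C , ℓ'∈Lc' =
    close-labels⇒¬Adj feasible k≤n∸1 (close c c' ℓ ℓ' c∈C c'∈C ℓ∈Lc ℓ'∈Lc')
      0<xcℓ 0<xc'ℓ' (clique c c' c∈C c'∈C c≢c')
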